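{- Let $G$ be a connected graph whose complement $\overline{G}$ is a tree $T$. A vertex $u$ of $G$ is avoidable in $G$ if and only if $u$ is a non-leaf vertex of $T$.
   Context: All graphs are finite, simple and undirected. A vertex $v$ of a graph $G$ is avoidable if every induced path on three vertices with middle vertex $v$ is contained in an induced cycle of $G$. A leaf is a vertex of degree one. -}

module Defs where

open import Data.Nat using (ℕ; zero; suc; _+_; _<_)
open import Data.Nat.DivMod using (m%n<n)
open import Data.Fin using (Fin; toℕ; fromℕ<; _≟_)
open import Data.Bool using (Bool; true; false; not; _∧_; if_then_else_)
open import Data.List using (List; map; allFin)
open import Data.Nat.ListAction using (sum)
open import Data.Product using (Σ; _×_; _,_; ∃)
open import Data.Sum using (_⊎_)
open import Function.Definitions using (Injective)
open import Relation.Nullary using (¬_; yes; no)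
open import Relation.Nullary.Decidable using (⌊_⌋)
open import Relation.Binary.PropositionalEquality using (_≡_; _≢_; refl; sym)

record Graph (n : ℕ) : Set where
  field
    adj     : Fin n → Fin n → Bool
    adj-sym : ∀ u v → adj u v ≡ adj v u
    adj-irr : ∀ v → adj v v ≡ false
open Graph public

Adj : ∀ {n} → Graph n → Fin n → Fin n → Set
Adj G u v = adj G u v ≡ true

private
  eqb : ∀ {n} → Fin n → Fin n → Bool
  eqb u v = ⌊ u ≟ v ⌋

  eqb-sym : ∀ {n} (u v : Fin n) → eqb u v ≡ eqb v u
  eqb-sym u v with u ≟ v | v ≟ u
  ... | yes _ | yes _ = refl
  ... | no _  | no _  = refl
  ... | yes p | no q  with q (sym p)
  ... | ()
  eqb-sym u v | no p | yes q with p (sym q)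
  ... | ()

  eqb-refl : ∀ {n} (v : Fin n) → eqb v v ≡ true
  eqb-refl v with v ≟ v
  ... | yes _ = refl
  ... | no p with p refl
  ... | ()

  cadj-sym : ∀ {n} (G : Graph n) (u v : Fin n) →
             (not (adj G u v) ∧ not (eqb u v)) ≡ (not (adj G v u) ∧ not (eqb v u))
  cadj-sym G u v rewrite adj-sym G u v | eqb-sym u v = refl

  cadj-irr : ∀ {n} (G : Graph n) (v : Fin n) → (not (adj G v v) ∧ not (eqb v v)) ≡ false
  cadj-irr G v rewrite eqb-refl v with adj G v v
  ... | true = refl
  ... | false = refl

complement : ∀ {n} → Graph n → Graph n
complement G = record
  { adj     = λ u v → not (adj G u v) ∧ not (eqb u v)
  ; adj-sym = cadj-sym G
  ; adj-irr = cadj-irr G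
  }

data Reach {n} (G : Graph n) : Fin n → Fin n → Set where
  here : ∀ {v} → Reach G v v
  step : ∀ {u v w} → Adj G u v → Reach G v w → Reach G u w

Connected : ∀ {n} → Graph n → Set
Connected {n} G = ∀ (u v : Fin n) → Reach G u v

next : ∀ {m} → Fin (suc m) → Fin (suc m)
next {m} i = fromℕ< (m%n<n (suc (toℕ i)) (suc m))

record Cycle {n} (G : Graph n) : Set where
  field
    m     : ℕ
    vtx   : Fin (suc (suc (suc m))) → Fin n
    inj   : Injective _≡_ _≡_ vtx
    edges : ∀ i → Adj G (vtx i) (vtx (next i))
open Cycle public

InducedCycle : ∀ {n} (G : Graph n) → Cycle G → Set
InducedCycle G C = ∀ i j → Adj G (vtx C i) (vtx C j) → (j ≡ next i) ⊎ (i ≡ next j)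

OnCycle : ∀ {n} {G : Graph n} → Cycle G → Fin n → Set
OnCycle C x = ∃ λ i → vtx C i ≡ x

InducedP3 : ∀ {n} → Graph n → Fin n → Fin n → Fin n → Set
InducedP3 G x v y = Adj G x v × Adj G v y × x ≢ y × ¬ Adj G x y

Avoidable : ∀ {n} → Graph n → Fin n → Set
Avoidable G v = ∀ x y → InducedP3 G x v y →
  Σ (Cycle G) λ C → InducedCycle G C × OnCycle C x × OnCycle C v × OnCycle C y

Acyclic : ∀ {n} → Graph n → Set
Acyclic G = ¬ Cycle G

IsTree : ∀ {n} → Graph n → Set
IsTree G = Connected G × Acyclic G

degree : ∀ {n} → Graph n → Fin n → ℕ
degree {n} G v = sum (map (λ w → if adj G v w then 1 else 0) (allFin n))

Leaf : ∀ {n} → Graph n → Fin n → Set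
Leaf G v = degree G v ≡ 1

IsComplementOf : ∀ {n} → Graph n → Graph n → Set
IsComplementOf T G = ∀ u v → adj T u v ≡ adj (complement G) u v

-- In G a vertex u is adjacent to everything except itself and its T-neighbours.
-- If u is a leaf of T with neighbour p, then in an induced cycle of G through u every vertex
-- other than u and p is a cycle-neighbour of u; so for a path p - q - r of T the induced P₃
-- q - u - r of G lies on no induced cycle, and if there is no such path, T is a star at p and
-- p is isolated in G. If u has two T-neighbours p₁, p₂ and x - u - y is an induced P₃ of G, then
-- x - y is an edge of T; a pᵢ adjacent in T to neither x nor y closes the induced square
-- x - u - y - pᵢ of G, and otherwise p₁, p₂, x, y close a cycle of T through u.
module Submission where

open import Defs
open import Data.Bool using (Bool; true; false; if_then_else_)
import Data.Bool as Bool
open import Data.Empty using (⊥; ⊥-elim)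
open import Data.Fin using (Fin; zero; suc; toℕ; fromℕ; inject₁; _≟_)
open import Data.Fin.Patterns using (0F; 1F; 2F; 3F; 4F)
open import Data.Fin.Properties
  using (toℕ-injective; toℕ<n; toℕ-fromℕ<; toℕ-fromℕ; toℕ-inject₁; any?)
  renaming (suc-injective to Fin-suc-injective)
open import Data.List using (tabulate)
open import Data.List.Properties using (map-tabulate)
open import Data.Nat using (ℕ; zero; suc; _≤_; _<_; z≤n; s≤s; s≤s⁻¹; _%_)
  renaming (_≟_ to _≟ℕ_)
open import Data.Nat.DivMod using (n%n≡0; m<n⇒m%n≡m; m%n<n)
open import Data.Nat.ListAction using (sum)
open import Data.Nat.Properties
  using (suc-injective; m+n≡0⇒n≡0; ≤∧≢⇒<; <⇒≤pred; <-irrefl; 0≢1+n; m≢1+n+m)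
open import Data.Product using (Σ; _×_; _,_; ∃)
open import Data.Sum using (_⊎_; inj₁; inj₂; [_,_]′)
open import Data.Vec using ([]; _∷_; lookup)
open import Data.Vec.Relation.Unary.All using ([]; _∷_)
open import Data.Vec.Relation.Unary.AllPairs using ([]; _∷_)
open import Data.Vec.Relation.Unary.Unique.Propositional using (Unique)
open import Data.Vec.Relation.Unary.Unique.Propositional.Properties using (lookup-injective)
open import Function using (_∘_; id)
open import Relation.Nullary using (¬_; Dec; yes; no; contradiction)
open import Relation.Nullary.Decidable using (_×-dec_; _⊎-dec_; ¬?)
open import Relation.Binary.PropositionalEquality
  using (_≡_; _≢_; refl; sym; trans; cong; subst)

data NextView {m} (i : Fin (suc m)) : Set where
  wraps : toℕ i ≡ m → next i ≡ zero → NextView i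
  steps : toℕ i < m → toℕ (next i) ≡ suc (toℕ i) → NextView i

nextView : ∀ {m} (i : Fin (suc m)) → NextView i
nextView {m} i with toℕ i ≟ℕ m
... | yes i≡m = wraps i≡m (toℕ-injective toℕ-next≡0)
  where
  toℕ-next≡0 : toℕ (next i) ≡ 0
  toℕ-next≡0 = trans (toℕ-fromℕ< (m%n<n (suc (toℕ i)) (suc m)))
                     (trans (cong (λ k → suc k % suc m) i≡m) (n%n≡0 (suc m)))
... | no i≢m = steps i<m (trans (toℕ-fromℕ< (m%n<n (suc (toℕ i)) (suc m))) (m<n⇒m%n≡m (s≤s i<m)))
  where
  i<m : toℕ i < m
  i<m = ≤∧≢⇒< (<⇒≤pred (toℕ<n i)) i≢m

next-injective : ∀ {m} {i j : Fin (suc m)} → next i ≡ next j → i ≡ j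
next-injective {i = i} {j} e with nextView i | nextView j
... | wraps i≡m _ | wraps j≡m _ = toℕ-injective (trans i≡m (sym j≡m))
... | wraps _ i↦0 | steps _ j↦ = contradiction (trans (sym (cong toℕ (trans (sym e) i↦0))) j↦) 0≢1+n
... | steps _ i↦ | wraps _ j↦0 = contradiction (trans (sym (cong toℕ (trans e j↦0))) i↦) 0≢1+n
... | steps _ i↦ | steps _ j↦ = toℕ-injective (suc-injective (trans (sym i↦) (trans (cong toℕ e) j↦)))

next-surjective : ∀ {m} (j : Fin (suc m)) → ∃ λ i → next i ≡ j
next-surjective {m} zero with nextView (fromℕ m)
... | wraps _ last↦0 = fromℕ m , last↦0
... | steps last<m _ = ⊥-elim (<-irrefl (toℕ-fromℕ m) last<m)
next-surjective {suc m} (suc j) with nextView (inject₁ j)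
... | wraps j≡m _ = ⊥-elim (<-irrefl (trans (sym (toℕ-inject₁ j)) j≡m) (toℕ<n j))
... | steps _ j↦ = inject₁ j , toℕ-injective (trans j↦ (cong suc (toℕ-inject₁ j)))

-- Needs at least three points: on Fin 2, next ∘ next is the identity.
next∘next≢id : ∀ {m} (i : Fin (suc (suc (suc m)))) → next (next i) ≢ i
next∘next≢id i e with nextView i | nextView (next i)
... | wraps _ i↦0 | wraps i′≡m _ = contradiction (trans (sym (cong toℕ i↦0)) i′≡m) 0≢1+n
... | wraps i≡m i↦0 | steps _ i′↦ =
  contradiction (sym (suc-injective (trans (sym i≡m) (trans (sym (cong toℕ e))
                                           (trans i′↦ (cong (suc ∘ toℕ) i↦0)))))) 0≢1+n
... | steps _ i↦ | wraps i′≡m i′↦0 =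
  contradiction (trans (sym (cong toℕ (trans (sym e) i′↦0))) (suc-injective (trans (sym i↦) i′≡m))) 0≢1+n
... | steps _ i↦ | steps _ i′↦ =
  m≢1+n+m (toℕ i) (trans (sym (cong toℕ e)) (trans i′↦ (cong suc i↦)))

count : ∀ {n} → (Fin n → Bool) → ℕ
count f = sum (tabulate λ w → if f w then 1 else 0)

degree≡count : ∀ {n} (G : Graph n) v → degree G v ≡ count (adj G v)
degree≡count G v = cong sum (map-tabulate id (λ w → if adj G v w then 1 else 0))

count≡0⇒false : ∀ {n} (f : Fin n → Bool) → count f ≡ 0 → ∀ a → f a ≡ false
count≡0⇒false f c zero with f zero
... | false = refl
count≡0⇒false f () zero | true
count≡0⇒false f c (suc a) = count≡0⇒false (f ∘ suc) (m+n≡0⇒n≡0 _ c) a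

1≤count⇒true : ∀ {n} (f : Fin n → Bool) → 1 ≤ count f → ∃ λ a → f a ≡ true
1≤count⇒true {suc n} f c with f zero in f0
... | true = zero , f0
... | false = let a , fa = 1≤count⇒true (f ∘ suc) c in suc a , fa

count≡1⇒unique : ∀ {n} (f : Fin n → Bool) → count f ≡ 1 →
                 Σ (Fin n) λ a → f a ≡ true × (∀ b → f b ≡ true → b ≡ a)
count≡1⇒unique {suc n} f c with f zero in f0
... | true = zero , f0 , λ
  { zero _ → refl
  ; (suc b) fb → contradiction (trans (sym fb) (count≡0⇒false (f ∘ suc) (suc-injective c) b)) λ ()
  }
... | false = let a , fa , unique = count≡1⇒unique (f ∘ suc) c in suc a , fa , λ
  { zero f0′ → contradiction (trans (sym f0′) f0) λ ()
  ; (suc b) fb → cong suc (unique b fb)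
  }

2≤count⇒distinct : ∀ {n} (f : Fin n → Bool) → 2 ≤ count f →
                   Σ (Fin n) λ a → Σ (Fin n) λ b → a ≢ b × f a ≡ true × f b ≡ true
2≤count⇒distinct {suc n} f c with f zero in f0
... | true = let b , fb = 1≤count⇒true (f ∘ suc) (s≤s⁻¹ c) in zero , suc b , (λ ()) , f0 , fb
... | false = let a , b , a≢b , fa , fb = 2≤count⇒distinct (f ∘ suc) c
              in suc a , suc b , a≢b ∘ Fin-suc-injective , fa , fb

module _ {n} (G : Graph n) where

  Adj-sym : ∀ {a b} → Adj G a b → Adj G b a
  Adj-sym {a} {b} ab = trans (adj-sym G b a) ab

  Adj⇒≢ : ∀ {a b} → Adj G a b → a ≢ b
  Adj⇒≢ {a} aa refl = contradiction (trans (sym aa) (adj-irr G a)) λ ()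

  Adj? : ∀ a b → Dec (Adj G a b)
  Adj? a b = adj G a b Bool.≟ true

  Reach-preserves : ∀ {P : Fin n → Set} → (∀ {a b} → P a → Adj G a b → P b) →
                    ∀ {v w} → P v → Reach G v w → P w
  Reach-preserves closed Pv here = Pv
  Reach-preserves closed Pv (step e r) = Reach-preserves closed (closed Pv e) r

  Reach-from-isolated : ∀ {v w} → (∀ x → ¬ Adj G v x) → Reach G v w → v ≡ w
  Reach-from-isolated isolated here = refl
  Reach-from-isolated isolated (step e _) = ⊥-elim (isolated _ e)

  leaf⇒unique-neighbour : ∀ {v} → Leaf G v → Σ (Fin n) λ p → Adj G v p × (∀ w → Adj G v w → w ≡ p)
  leaf⇒unique-neighbour {v} leaf = count≡1⇒unique (adj G v) (trans (sym (degree≡count G v)) leaf)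

  ¬leaf⇒isolated⊎branching : ∀ {v} → ¬ Leaf G v →
    (∀ w → ¬ Adj G v w) ⊎ (Σ (Fin n) λ p → Σ (Fin n) λ q → p ≢ q × Adj G v p × Adj G v q)
  ¬leaf⇒isolated⊎branching {v} ¬leaf with count (adj G v) in c
  ... | zero = inj₁ λ w vw → contradiction (trans (sym vw) (count≡0⇒false (adj G v) c w)) λ ()
  ... | suc zero = ⊥-elim (¬leaf (trans (degree≡count G v) c))
  ... | suc (suc _) = inj₂ (2≤count⇒distinct (adj G v) (subst (2 ≤_) (sym c) (s≤s (s≤s z≤n))))

  cycle₄ : ∀ {a b c d} → Unique (a ∷ b ∷ c ∷ d ∷ []) →
           Adj G a b → Adj G b c → Adj G c d → Adj G d a → Cycle G
  cycle₄ {a} {b} {c} {d} distinct ab bc cd da = record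
    { m = 1
    ; vtx = lookup (a ∷ b ∷ c ∷ d ∷ [])
    ; inj = λ {i} {j} → lookup-injective distinct i j
    ; edges = λ { 0F → ab ; 1F → bc ; 2F → cd ; 3F → da }
    }

  cycle₅ : ∀ {a b c d e} → Unique (a ∷ b ∷ c ∷ d ∷ e ∷ []) →
           Adj G a b → Adj G b c → Adj G c d → Adj G d e → Adj G e a → Cycle G
  cycle₅ {a} {b} {c} {d} {e} distinct ab bc cd de ea = record
    { m = 2
    ; vtx = lookup (a ∷ b ∷ c ∷ d ∷ e ∷ [])
    ; inj = λ {i} {j} → lookup-injective distinct i j
    ; edges = λ { 0F → ab ; 1F → bc ; 2F → cd ; 3F → de ; 4F → ea }
    }

  cycle₄-induced : ∀ {a b c d} (distinct : Unique (a ∷ b ∷ c ∷ d ∷ []))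
                   (ab : Adj G a b) (bc : Adj G b c) (cd : Adj G c d) (da : Adj G d a) →
                   ¬ Adj G a c → ¬ Adj G b d → InducedCycle G (cycle₄ distinct ab bc cd da)
  cycle₄-induced _ _ _ _ _ ¬ac ¬bd = λ
    { 0F 1F _ → inj₁ refl ; 1F 2F _ → inj₁ refl ; 2F 3F _ → inj₁ refl ; 3F 0F _ → inj₁ refl
    ; 1F 0F _ → inj₂ refl ; 2F 1F _ → inj₂ refl ; 3F 2F _ → inj₂ refl ; 0F 3F _ → inj₂ refl
    ; 0F 2F ac → ⊥-elim (¬ac ac) ; 2F 0F ca → ⊥-elim (¬ac (Adj-sym ca))
    ; 1F 3F bd → ⊥-elim (¬bd bd) ; 3F 1F db → ⊥-elim (¬bd (Adj-sym db))
    ; 0F 0F aa → ⊥-elim (Adj⇒≢ aa refl) ; 1F 1F bb → ⊥-elim (Adj⇒≢ bb refl)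
    ; 2F 2F cc → ⊥-elim (Adj⇒≢ cc refl) ; 3F 3F dd → ⊥-elim (Adj⇒≢ dd refl)
    }

Consecutive : ∀ {m} → Fin (suc m) → Fin (suc m) → Set
Consecutive i j = j ≡ next i ⊎ i ≡ next j

consecutive-atMostTwo : ∀ {m} {i j k l : Fin (suc m)} →
  Consecutive i j → Consecutive i k → Consecutive i l → j ≢ k → l ≢ j → l ≡ k
consecutive-atMostTwo (inj₁ refl) (inj₁ refl) _ j≢k _ = ⊥-elim (j≢k refl)
consecutive-atMostTwo (inj₁ refl) _ (inj₁ refl) _ l≢j = ⊥-elim (l≢j refl)
consecutive-atMostTwo (inj₁ _) (inj₂ i≡k⁺) (inj₂ i≡l⁺) _ _ = next-injective (trans (sym i≡l⁺) i≡k⁺)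
consecutive-atMostTwo (inj₂ i≡j⁺) (inj₂ i≡k⁺) _ j≢k _ = ⊥-elim (j≢k (next-injective (trans (sym i≡j⁺) i≡k⁺)))
consecutive-atMostTwo (inj₂ i≡j⁺) _ (inj₂ i≡l⁺) _ l≢j = ⊥-elim (l≢j (next-injective (trans (sym i≡l⁺) i≡j⁺)))
consecutive-atMostTwo (inj₂ _) (inj₁ refl) (inj₁ refl) _ _ = refl

consecutive-onward : ∀ {m} {i j : Fin (suc (suc (suc m)))} → Consecutive i j →
                     ∃ λ l → Consecutive j l × l ≢ i
consecutive-onward {i = i} (inj₁ refl) = next (next i) , inj₁ refl , next∘next≢id i
consecutive-onward {j = j} (inj₂ refl) with next-surjective j
... | l , refl = l , inj₂ refl , λ l≡i → next∘next≢id l (sym l≡i)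

consecutive⇒Adj : ∀ {n} {G : Graph n} (C : Cycle G) {i j} → Consecutive i j → Adj G (vtx C i) (vtx C j)
consecutive⇒Adj C {i} (inj₁ refl) = edges C i
consecutive⇒Adj {G = G} C {j = j} (inj₂ refl) = Adj-sym G (edges C j)

UniversalExcept : ∀ {n} → Graph n → Fin n → Fin n → Set
UniversalExcept G u p = ∀ w → w ≢ u → w ≢ p → Adj G u w

-- Walk from q along C away from u: the next vertex is adjacent to q and is not u,
-- so it is p or, being adjacent to u in an induced cycle, it is u's other cycle-neighbour r.
inducedCycle-universalExcept : ∀ {n} {G : Graph n} {u p q r} (C : Cycle G) → InducedCycle G C →
  UniversalExcept G u p → Adj G u q → Adj G u r → q ≢ r →
  OnCycle C u → OnCycle C q → OnCycle C r → Adj G q r ⊎ Adj G q p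
inducedCycle-universalExcept {G = G} {p = p} C induced universal uq ur q≢r (i , refl) (j , refl) (k , refl)
  with consecutive-onward (induced i j uq)
... | l , jl , l≢i with vtx C l ≟ p
...   | yes refl = inj₂ (consecutive⇒Adj C jl)
...   | no l≢p = inj₁ (subst (Adj G (vtx C j) ∘ vtx C) l≡k (consecutive⇒Adj C jl))
  where
  il : Consecutive i l
  il = induced i l (universal (vtx C l) (l≢i ∘ inj C) l≢p)
  l≡k : l ≡ k
  l≡k = consecutive-atMostTwo (induced i j uq) (induced i k ur) il (q≢r ∘ cong (vtx C))
          (λ l≡j → Adj⇒≢ G (consecutive⇒Adj C jl) (cong (vtx C) (sym l≡j)))

P₃From : ∀ {n} → Graph n → Fin n → Set
P₃From G p = ∃ λ q → Adj G p q × ∃ λ r → Adj G q r × r ≢ p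

P₃From? : ∀ {n} (G : Graph n) p → Dec (P₃From G p)
P₃From? G p = any? λ q → Adj? G p q ×-dec any? λ r → Adj? G q r ×-dec ¬? (r ≟ p)

¬P₃From⇒star : ∀ {n} (G : Graph n) → Connected G → ∀ {p} → ¬ P₃From G p → ∀ w → w ≡ p ⊎ Adj G p w
¬P₃From⇒star G connected {p} ¬P₃ w = Reach-preserves G closed (inj₁ refl) (connected p w)
  where
  closed : ∀ {a b} → a ≡ p ⊎ Adj G p a → Adj G a b → b ≡ p ⊎ Adj G p b
  closed (inj₁ refl) pb = inj₂ pb
  closed {a} {b} (inj₂ pa) ab with b ≟ p
  ... | yes b≡p = inj₁ b≡p
  ... | no b≢p = ⊥-elim (¬P₃ (a , pa , b , ab , b≢p))

InducedCycleThrough : ∀ {n} → Graph n → Fin n → Fin n → Fin n → Set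
InducedCycleThrough G x u y = Σ (Cycle G) λ C → InducedCycle G C × OnCycle C x × OnCycle C u × OnCycle C y

module Complement {n} {G T : Graph n} (T≡Gᶜ : IsComplementOf T G) where

  T⇒¬G : ∀ {a b} → Adj T a b → ¬ Adj G a b
  T⇒¬G {a} {b} ab with adj G a b | T≡Gᶜ a b
  ... | true  | T≡false = λ _ → contradiction (trans (sym ab) T≡false) λ ()
  ... | false | _       = λ ()

  ¬T⇒G : ∀ {a b} → a ≢ b → ¬ Adj T a b → Adj G a b
  ¬T⇒G {a} {b} a≢b ¬ab with adj G a b | a ≟ b | T≡Gᶜ a b
  ... | true  | _        | _      = refl
  ... | false | yes a≡b  | _      = ⊥-elim (a≢b a≡b)
  ... | false | no _     | T≡true = ⊥-elim (¬ab T≡true)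

  ¬G⇒T : ∀ {a b} → a ≢ b → ¬ Adj G a b → Adj T a b
  ¬G⇒T {a} {b} a≢b ¬ab with adj G a b | a ≟ b | T≡Gᶜ a b
  ... | true  | _        | _      = ⊥-elim (¬ab refl)
  ... | false | yes a≡b  | _      = ⊥-elim (a≢b a≡b)
  ... | false | no _     | T≡true = T≡true

  module _ {u p} (up : Adj T u p) (unique : ∀ w → Adj T u w → w ≡ p) where

    universalExcept : UniversalExcept G u p
    universalExcept w w≢u w≢p = ¬T⇒G (w≢u ∘ sym) (w≢p ∘ unique w)

    P₃From⇒¬avoidable : P₃From T p → ¬ Avoidable G u
    P₃From⇒¬avoidable (q , pq , r , qr , r≢p) avoidable =
      let C , induced , onq , onu , onr = avoidable q r (Adj-sym G uq , ur , q≢r , T⇒¬G qr)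
      in [ T⇒¬G qr , T⇒¬G (Adj-sym T pq) ]′
           (inducedCycle-universalExcept C induced universalExcept uq ur q≢r onu onq onr)
      where
      q≢r : q ≢ r
      q≢r = Adj⇒≢ T qr
      uq : Adj G u q
      uq = universalExcept q (λ { refl → r≢p (unique r qr) }) (Adj⇒≢ T pq ∘ sym)
      ur : Adj G u r
      ur = universalExcept r (λ { refl → Adj⇒≢ T pq (sym (unique q (Adj-sym T qr))) }) r≢p

  leaf⇒¬avoidable : Connected G → Connected T → ∀ {u} → Leaf T u → ¬ Avoidable G u
  leaf⇒¬avoidable connectedG connectedT {u} leaf avoidable with leaf⇒unique-neighbour T leaf
  ... | p , up , unique with P₃From? T p
  ...   | yes P₃ = P₃From⇒¬avoidable up unique P₃ avoidable
  ...   | no ¬P₃ = Adj⇒≢ T up (sym (Reach-from-isolated G p-isolated (connectedG p u)))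
    where
    p-isolated : ∀ w → ¬ Adj G p w
    p-isolated w with ¬P₃From⇒star T connectedT ¬P₃ w
    ... | inj₁ refl = λ pp → Adj⇒≢ G pp refl
    ... | inj₂ pw = T⇒¬G pw

  joinedNeighbours⇒cycle : ∀ {u p₁ p₂ a b} → Adj T u p₁ → Adj T u p₂ → p₁ ≢ p₂ →
    Adj G u a → Adj G u b → Adj T p₁ a → Adj T p₂ b → a ≡ b ⊎ Adj T a b → Cycle T
  joinedNeighbours⇒cycle up₁ up₂ p₁≢p₂ ua _ p₁a p₂a (inj₁ refl) =
    cycle₄ T ((Adj⇒≢ T up₁ ∷ Adj⇒≢ G ua ∷ Adj⇒≢ T up₂ ∷ [])
           ∷ (Adj⇒≢ T p₁a ∷ p₁≢p₂ ∷ [])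
           ∷ ((Adj⇒≢ T p₂a ∘ sym) ∷ [])
           ∷ [] ∷ [])
      up₁ p₁a (Adj-sym T p₂a) (Adj-sym T up₂)
  joinedNeighbours⇒cycle up₁ up₂ p₁≢p₂ ua ub p₁a p₂b (inj₂ ab) =
    cycle₅ T ((Adj⇒≢ T up₁ ∷ Adj⇒≢ G ua ∷ Adj⇒≢ G ub ∷ Adj⇒≢ T up₂ ∷ [])
           ∷ (Adj⇒≢ T p₁a ∷ (λ { refl → T⇒¬G up₁ ub }) ∷ p₁≢p₂ ∷ [])
           ∷ (Adj⇒≢ T ab ∷ (λ { refl → T⇒¬G up₂ ua }) ∷ [])
           ∷ ((Adj⇒≢ T p₂b ∘ sym) ∷ [])
           ∷ [] ∷ [])
      up₁ p₁a ab (Adj-sym T p₂b) (Adj-sym T up₂)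

  module _ {x u y} (xu : Adj G x u) (uy : Adj G u y) (x≢y : x ≢ y) (¬xy : ¬ Adj G x y) where

    inducedSquare : ∀ {p} → Adj T u p → ¬ Adj T p x → ¬ Adj T p y → InducedCycleThrough G x u y
    inducedSquare {p} up ¬px ¬py =
      cycle₄ G distinct xu uy yp px , cycle₄-induced G distinct xu uy yp px ¬xy (T⇒¬G up) ,
      (0F , refl) , (1F , refl) , (2F , refl)
      where
      x≢p : x ≢ p
      x≢p refl = T⇒¬G up (Adj-sym G xu)
      y≢p : y ≢ p
      y≢p refl = T⇒¬G up uy
      distinct : Unique (x ∷ u ∷ y ∷ p ∷ [])
      distinct = (Adj⇒≢ G xu ∷ x≢y ∷ x≢p ∷ []) ∷ (Adj⇒≢ G uy ∷ Adj⇒≢ T up ∷ []) ∷ (y≢p ∷ []) ∷ [] ∷ []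
      yp : Adj G y p
      yp = ¬T⇒G y≢p (¬py ∘ Adj-sym T)
      px : Adj G p x
      px = ¬T⇒G (x≢p ∘ sym) ¬px

    attachedNeighbours⇒cycle : ∀ {p₁ p₂} → Adj T u p₁ → Adj T u p₂ → p₁ ≢ p₂ →
      Adj T p₁ x ⊎ Adj T p₁ y → Adj T p₂ x ⊎ Adj T p₂ y → Cycle T
    attachedNeighbours⇒cycle {p₁} {p₂} up₁ up₂ p₁≢p₂ = λ
      { (inj₁ p₁x) (inj₁ p₂x) → joined ux ux p₁x p₂x (inj₁ refl)
      ; (inj₁ p₁x) (inj₂ p₂y) → joined ux uy p₁x p₂y (inj₂ xy)
      ; (inj₂ p₁y) (inj₁ p₂x) → joined uy ux p₁y p₂x (inj₂ (Adj-sym T xy))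
      ; (inj₂ p₁y) (inj₂ p₂y) → joined uy uy p₁y p₂y (inj₁ refl)
      }
      where
      joined : ∀ {a b} → Adj G u a → Adj G u b → Adj T p₁ a → Adj T p₂ b → a ≡ b ⊎ Adj T a b → Cycle T
      joined = joinedNeighbours⇒cycle up₁ up₂ p₁≢p₂
      ux : Adj G u x
      ux = Adj-sym G xu
      xy : Adj T x y
      xy = ¬G⇒T x≢y ¬xy

  ¬leaf⇒avoidable : Connected T → Acyclic T → ∀ {u} → ¬ Leaf T u → Avoidable G u
  ¬leaf⇒avoidable connectedT acyclic {u} ¬leaf x y (xu , uy , x≢y , ¬xy)
    with ¬leaf⇒isolated⊎branching T ¬leaf
  ... | inj₁ isolated = ⊥-elim (Adj⇒≢ G xu (sym (Reach-from-isolated T isolated (connectedT u x))))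
  ... | inj₂ (p₁ , p₂ , p₁≢p₂ , up₁ , up₂) with attached? p₁ | attached? p₂
    where
    attached? : ∀ p → Dec (Adj T p x ⊎ Adj T p y)
    attached? p = Adj? T p x ⊎-dec Adj? T p y
  ... | no ¬attached | _ = inducedSquare xu uy x≢y ¬xy up₁ (¬attached ∘ inj₁) (¬attached ∘ inj₂)
  ... | _ | no ¬attached = inducedSquare xu uy x≢y ¬xy up₂ (¬attached ∘ inj₁) (¬attached ∘ inj₂)
  ... | yes attached₁ | yes attached₂ =
    ⊥-elim (acyclic (attachedNeighbours⇒cycle xu uy x≢y ¬xy up₁ up₂ p₁≢p₂ attached₁ attached₂))

lemma10 : ∀ {n} (G T : Graph n) → Connected G → IsTree T → IsComplementOf T G →
          ∀ (u : Fin n) → (Avoidable G u → ¬ Leaf T u) × (¬ Leaf T u → Avoidable G u)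
lemma10 G T connectedG (connectedT , acyclic) T≡Gᶜ u =
  (λ avoidable leaf → leaf⇒¬avoidable connectedG connectedT leaf avoidable) ,
  ¬leaf⇒avoidable connectedT acyclic
  where open Complement T≡Gᶜ
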